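{- Let $Q$ be finite, $\rho:Q\to\mathbb{N}$ with maximum $m$, and $\mathcal{D}^k$, $\mathrm{fix}^k_A$ as in the context. For every $0\le k\le m$ and every type $A$: the map $\mathrm{fix}^k_A:\mathcal{D}^k_{A\to A}\to\mathcal{D}^k_A$ is monotone; if $k>0$ then $(\mathrm{fix}^{k-1}_A,\mathrm{fix}^k_A)\in\mathcal{L}^k_{(A\to A)\to A}$; and for every $f\in\mathcal{D}^k_{A\to A}$, $f(\mathrm{fix}^k_A(f))=\mathrm{fix}^k_A(f)$.
   Context: $Q_k=\{q:\rho(q)=k\}$, $Q_{\le k}=\{q:\rho(q)\le k\}$. $\mathcal{D}^0_o=\mathcal{P}(Q_0)$, $\mathcal{D}^0_{A\to B}$ = monotone maps $\mathcal{D}^0_A\to\mathcal{D}^0_B$; for $k>0$: $\mathcal{D}^k_o=\mathcal{P}(Q_{\le k})$, $\mathcal{L}^k_o=\{(R,P): R=P\cap Q_{\le k-1}\}$, $\mathcal{L}^k_{A\to B}=\{(f_1,f_2): f_1\in\mathcal{D}^{k-1}_{A\to B}$, $f_2$ monotone $\mathcal{D}^k_A\to\mathcal{D}^k_B$, $(f_1(g_1),f_2(g_2))\in\mathcal{L}^k_B$ whenever $(g_1,g_2)\in\mathcal{L}^k_A\}$, $\mathcal{D}^k_{A\to B}=\{f_2:\exists f_1,(f_1,f_2)\in\mathcal{L}^k_{A\to B}\}$; order: inclusion at $o$, pointwise at arrows; $\top^k_A$ greatest element. $e^\downarrow$ is the unique $d$ with $(d,e)\in\mathcal{L}^k_A$;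 $d^{\uparrow\top}$, $d^{\uparrow\bot}$ are the greatest and least $e$ with $(d,e)\in\mathcal{L}^k_A$. Fixpoints: $\mathrm{fix}^0_A(f)=\bigwedge_{n\ge0}f^n(\top^0_A)$; for $0<2k\le m$ and $f\in\mathcal{D}^{2k}_{A\to A}$, $\mathrm{fix}^{2k}_A(f)=\bigwedge_{n\ge0}f^n(e)$ with $e=(\mathrm{fix}^{2k-1}_A(f^\downarrow))^{\uparrow\top}$; for $0<2k+1\le m$ and $f\in\mathcal{D}^{2k+1}_{A\to A}$, $\mathrm{fix}^{2k+1}_A(f)=\bigvee_{n\ge0}f^n(d)$ with $d=(\mathrm{fix}^{2k}_A(f^\downarrow))^{\uparrow\bot}$. -}

module Defs where

open import Level using (Lift; lift; lower) renaming (suc to lsuc; zero to lzero)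
open import Data.Nat using (ℕ; zero; suc; _≤_; _⊔_)
open import Data.Nat.Properties using (≤-irrelevant; m≤n⇒m≤1+n)
open import Data.Fin using (Fin)
open import Data.List using (foldr; map; allFin)
open import Data.Product using (Σ; _×_; _,_; proj₁; proj₂)
open import Data.Unit using (⊤; tt)
open import Data.Bool using (Bool; true; false; not; if_then_else_)
open import Relation.Binary.PropositionalEquality using (subst)

data Ty : Set where
  o   : Ty
  _⇒_ : Ty → Ty → Ty
infixr 5 _⇒_

-- m = maximum of ρ over Q = Fin N (0 if Q is empty).
maxρ : ∀ {N} → (Fin N → ℕ) → ℕ
maxρ {N} ρ = foldr _⊔_ 0 (map ρ (allFin N))

isEven : ℕ → Bool
isEven zero    = true
isEven (suc n) = not (isEven n)

iter : ∀ {X : Set₁} → (X → X) → ℕ → X → X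
iter f zero    x = x
iter f (suc n) x = f (iter f n x)

module Dom {N : ℕ} (ρ : Fin N → ℕ) where

  -- Q_{≤ j}   (note Q_0 = Q_{≤0})
  Q≤ : ℕ → Set
  Q≤ j = Σ (Fin N) (λ q → ρ q ≤ j)

  mutual
    -- D j A  is  𝒟^j_A ; subsets are predicates on Q_{≤ j}
    D : ℕ → Ty → Set₁
    D j o       = Q≤ j → Set
    D j (A ⇒ B) = Σ (D j A → D j B) (IsD j A B)

    Le : ∀ j A → D j A → D j A → Set₁
    Le j o P P'       = Lift (lsuc lzero) (∀ q → P q → P' q)
    Le j (A ⇒ B) f g  = ∀ x → Le j B (proj₁ f x) (proj₁ g x)

    Mono : ∀ j A B → (D j A → D j B) → Set₁
    Mono j A B f = ∀ x y → Le j A x y → Le j B (f x) (f y)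

    IsD : ∀ j A B → (D j A → D j B) → Set₁
    IsD zero    A B f = Mono zero A B f
    IsD (suc j) A B f = Mono (suc j) A B f
                      × Σ (D j (A ⇒ B)) (λ f1 → LPres' j (suc j) A B (proj₁ f1) f)

    -- L' i k A  relates D i A and D k A; it is only used with k = suc i,
    -- where it is exactly ℒ^k_A (see L below).  At o: R = P ∩ Q_{≤ i}.
    L' : ∀ i k A → D i A → D k A → Set₁
    L' i k o R P = Lift (lsuc lzero) (∀ q (h : ρ q ≤ i) (h' : ρ q ≤ k) →
                  (R (q , h) → P (q , h')) × (P (q , h') → R (q , h)))
    L' i k (A ⇒ B) f1 f2 = LPres' i k A B (proj₁ f1) (proj₁ f2)

    LPres' : ∀ i k A B → (D i A → D i B) → (D k A → D k B) → Set₁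
    LPres' i k A B f1 f2 = ∀ g1 g2 → L' i k A g1 g2 → L' i k B (f1 g1) (f2 g2)

  -- L j A  is  ℒ^{j+1}_A
  L : ∀ j A → D j A → D (suc j) A → Set₁
  L j = L' j (suc j)

  LPres : ∀ j A B → (D j A → D j B) → (D (suc j) A → D (suc j) B) → Set₁
  LPres j = LPres' j (suc j)

  LRaw : ∀ j A B → (D j A → D j B) → (D (suc j) A → D (suc j) B) → Set₁
  LRaw j A B f1 f2 = IsD j A B f1 × Mono (suc j) A B f2 × LPres j A B f1 f2

  Eq : ∀ j A → D j A → D j A → Set₁
  Eq j A x y = Le j A x y × Le j A y x

  Le-refl : ∀ j A x → Le j A x x
  Le-refl j o P = lift (λ q p → p)
  Le-refl j (A ⇒ B) f = λ x → Le-refl j B (proj₁ f x)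

  Le-trans : ∀ j A {x y z} → Le j A x y → Le j A y z → Le j A x z
  Le-trans j o xy yz = lift (λ q p → lower yz q (lower xy q p))
  Le-trans j (A ⇒ B) xy yz = λ a → Le-trans j B (xy a) (yz a)

  monoOf : ∀ j A B (f : D j (A ⇒ B)) → Mono j A B (proj₁ f)
  monoOf zero    A B f = proj₂ f
  monoOf (suc j) A B f = proj₁ (proj₂ f)

  mutual
    top : ∀ j A → D j A
    top j o       = λ _ → ⊤
    top j (A ⇒ B) = (λ _ → top j B) , top-isD j A B

    top-isD : ∀ j A B → IsD j A B (λ _ → top j B)
    top-isD zero    A B = λ _ _ _ → Le-refl zero B (top zero B)
    top-isD (suc j) A B = (λ _ _ _ → Le-refl (suc j) B (top (suc j) B))
                        , top j (A ⇒ B) , (λ _ _ _ → L-top j B)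

    L-top : ∀ j A → L j A (top j A) (top (suc j) A)
    L-top j o       = lift (λ q h h' → (λ _ → tt) , (λ _ → tt))
    L-top j (A ⇒ B) = λ _ _ _ → L-top j B

  mutual
    Meet : ∀ j A → (ℕ → D j A) → D j A
    Meet j o S       = λ q → ∀ n → S n q
    Meet j (A ⇒ B) S = (λ x → Meet j B (λ n → proj₁ (S n) x)) , Meet-isD j A B S

    Meet-isD : ∀ j A B (S : ℕ → D j (A ⇒ B)) → IsD j A B (λ x → Meet j B (λ n → proj₁ (S n) x))
    Meet-isD zero A B S = λ x y xy → Meet-mono zero B (λ n → proj₂ (S n) x y xy)
    Meet-isD (suc j) A B S =
        (λ x y xy → Meet-mono (suc j) B (λ n → proj₁ (proj₂ (S n)) x y xy))
      , Meet j (A ⇒ B) (λ n → proj₁ (proj₂ (proj₂ (S n))))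
      , (λ g1 g2 r → L-meet j B (λ n → proj₂ (proj₂ (proj₂ (S n))) g1 g2 r))

    Meet-mono : ∀ j A {S T : ℕ → D j A} → (∀ n → Le j A (S n) (T n)) → Le j A (Meet j A S) (Meet j A T)
    Meet-mono j o st = lift (λ q s n → lower (st n) q (s n))
    Meet-mono j (A ⇒ B) st = λ x → Meet-mono j B (λ n → st n x)

    L-meet : ∀ j A {R : ℕ → D j A} {P : ℕ → D (suc j) A} → (∀ n → L j A (R n) (P n))
           → L j A (Meet j A R) (Meet (suc j) A P)
    L-meet j o rp = lift (λ q h h' → (λ r n → proj₁ (lower (rp n) q h h') (r n))
                                , (λ p n → proj₂ (lower (rp n) q h h') (p n)))
    L-meet j (A ⇒ B) rp = λ g1 g2 r → L-meet j B (λ n → rp n g1 g2 r)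

  mutual
    Join : ∀ j A → (ℕ → D j A) → D j A
    Join j o S       = λ q → Σ ℕ (λ n → S n q)
    Join j (A ⇒ B) S = (λ x → Join j B (λ n → proj₁ (S n) x)) , Join-isD j A B S

    Join-isD : ∀ j A B (S : ℕ → D j (A ⇒ B)) → IsD j A B (λ x → Join j B (λ n → proj₁ (S n) x))
    Join-isD zero A B S = λ x y xy → Join-mono zero B (λ n → proj₂ (S n) x y xy)
    Join-isD (suc j) A B S =
        (λ x y xy → Join-mono (suc j) B (λ n → proj₁ (proj₂ (S n)) x y xy))
      , Join j (A ⇒ B) (λ n → proj₁ (proj₂ (proj₂ (S n))))
      , (λ g1 g2 r → L-join j B (λ n → proj₂ (proj₂ (proj₂ (S n))) g1 g2 r))

    Join-mono : ∀ j A {S T : ℕ → D j A} → (∀ n → Le j A (S n) (T n)) → Le j A (Join j A S) (Join j A T)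
    Join-mono j o st = lift (λ { q (n , s) → n , lower (st n) q s })
    Join-mono j (A ⇒ B) st = λ x → Join-mono j B (λ n → st n x)

    L-join : ∀ j A {R : ℕ → D j A} {P : ℕ → D (suc j) A} → (∀ n → L j A (R n) (P n))
           → L j A (Join j A R) (Join (suc j) A P)
    L-join j o rp = lift (λ q h h' → (λ { (n , r) → n , proj₁ (lower (rp n) q h h') r })
                                , (λ { (n , p) → n , proj₂ (lower (rp n) q h h') p }))
    L-join j (A ⇒ B) rp = λ g1 g2 r → L-join j B (λ n → rp n g1 g2 r)

  -- e^↓ : the (unique) d with (d , e) ∈ ℒ^{j+1}_A
  dn : ∀ j A → D (suc j) A → D j A
  dn j o P       = λ qh → P (proj₁ qh , m≤n⇒m≤1+n (proj₂ qh))
  dn j (A ⇒ B) f = proj₁ (proj₂ (proj₂ f))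

  L-respˡ : ∀ j A {x x' e} → Le j A x' x → Le j A x x' → L j A x e → L j A x' e
  L-respˡ j o a b l = lift (λ q h h' → (λ r → proj₁ (lower l q h h') (lower a (q , h) r))
                                  , (λ p → lower b (q , h) (proj₂ (lower l q h h') p)))
  L-respˡ j (A ⇒ B) a b l = λ g1 g2 r → L-respˡ j B (a g1) (b g1) (l g1 g2 r)

  -- d^{↑⊤} : greatest e with (d , e) ∈ ℒ^{j+1}_A
  mutual
    upT : ∀ j A → D j A → D (suc j) A
    upT j o d       = λ qh → (h' : ρ (proj₁ qh) ≤ j) → d (proj₁ qh , h')
    upT j (A ⇒ B) d = (λ g2 → upT j B (proj₁ d (dn j A g2)))
                    , (λ x y xy → upT-mono j B (monoOf j A B d _ _ (dn-mono j A xy)))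
                    , d , upT-L j A B d

    upT-L : ∀ j A B (d : D j (A ⇒ B)) → LPres j A B (proj₁ d) (λ g2 → upT j B (proj₁ d (dn j A g2)))
    upT-L j A B d g1 g2 r =
      L-respˡ j B (monoOf j A B d _ _ (proj₁ (L⇒≈dn j A r)))
                  (monoOf j A B d _ _ (proj₂ (L⇒≈dn j A r)))
                  (L-upT j B (proj₁ d (dn j A g2)))

    L-upT : ∀ j A d → L j A d (upT j A d)
    L-upT j o d = lift (λ q h h₁ → (λ r h' → subst (λ z → d (q , z)) (≤-irrelevant h h') r)
                              , (λ p → p h))
    L-upT j (A ⇒ B) d = upT-L j A B d

    upT-mono : ∀ j A {x y} → Le j A x y → Le (suc j) A (upT j A x) (upT j A y)
    upT-mono j o xy = lift (λ qh p h' → lower xy (proj₁ qh , h') (p h'))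
    upT-mono j (A ⇒ B) xy = λ g2 → upT-mono j B (xy (dn j A g2))

    dn-mono : ∀ j A {x y} → Le (suc j) A x y → Le j A (dn j A x) (dn j A y)
    dn-mono j o xy = lift (λ qh p → lower xy (proj₁ qh , m≤n⇒m≤1+n (proj₂ qh)) p)
    dn-mono j (A ⇒ B) {f} {g} fg = λ g1 →
      let u  = upT j A g1
          E1 = L⇒≈dn j B (proj₂ (proj₂ (proj₂ f)) g1 u (L-upT j A g1))
          E2 = L⇒≈dn j B (proj₂ (proj₂ (proj₂ g)) g1 u (L-upT j A g1))
      in Le-trans j B (proj₁ E1) (Le-trans j B (dn-mono j B (fg u)) (proj₂ E2))

    L⇒≈dn : ∀ j A {d e} → L j A d e → Eq j A d (dn j A e)
    L⇒≈dn j o l = lift (λ qh r → proj₁ (lower l (proj₁ qh) (proj₂ qh) (m≤n⇒m≤1+n (proj₂ qh))) r)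
                , lift (λ qh p → proj₂ (lower l (proj₁ qh) (proj₂ qh) (m≤n⇒m≤1+n (proj₂ qh))) p)
    L⇒≈dn j (A ⇒ B) {d} {e} l =
        (λ g1 → Le-trans j B (proj₁ (E1 g1)) (proj₂ (E2 g1)))
      , (λ g1 → Le-trans j B (proj₁ (E2 g1)) (proj₂ (E1 g1)))
      where
        E1 = λ g1 → L⇒≈dn j B (l g1 (upT j A g1) (L-upT j A g1))
        E2 = λ g1 → L⇒≈dn j B (proj₂ (proj₂ (proj₂ e)) g1 (upT j A g1) (L-upT j A g1))

  -- d^{↑⊥} : least e with (d , e) ∈ ℒ^{j+1}_A
  mutual
    upB : ∀ j A → D j A → D (suc j) A
    upB j o d       = λ qh → Σ (ρ (proj₁ qh) ≤ j) (λ h' → d (proj₁ qh , h'))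
    upB j (A ⇒ B) d = (λ g2 → upB j B (proj₁ d (dn j A g2)))
                    , (λ x y xy → upB-mono j B (monoOf j A B d _ _ (dn-mono j A xy)))
                    , d , upB-L j A B d

    upB-L : ∀ j A B (d : D j (A ⇒ B)) → LPres j A B (proj₁ d) (λ g2 → upB j B (proj₁ d (dn j A g2)))
    upB-L j A B d g1 g2 r =
      L-respˡ j B (monoOf j A B d _ _ (proj₁ (L⇒≈dn j A r)))
                  (monoOf j A B d _ _ (proj₂ (L⇒≈dn j A r)))
                  (L-upB j B (proj₁ d (dn j A g2)))

    L-upB : ∀ j A d → L j A d (upB j A d)
    L-upB j o d = lift (λ q h h₁ → (λ r → h , r)
                              , (λ p → subst (λ z → d (q , z)) (≤-irrelevant (proj₁ p) h) (proj₂ p)))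
    L-upB j (A ⇒ B) d = upB-L j A B d

    upB-mono : ∀ j A {x y} → Le j A x y → Le (suc j) A (upB j A x) (upB j A y)
    upB-mono j o xy = lift (λ qh p → proj₁ p , lower xy (proj₁ qh , proj₁ p) (proj₂ p))
    upB-mono j (A ⇒ B) xy = λ g2 → upB-mono j B (xy (dn j A g2))

  fix : ∀ j A → D j (A ⇒ A) → D j A
  fix zero A f = Meet zero A (λ n → iter (proj₁ f) n (top zero A))
  fix (suc j) A f =
    if isEven (suc j)
    then Meet (suc j) A (λ n → iter (proj₁ f) n (upT j A (fix j A (dn j (A ⇒ A) f))))
    else Join (suc j) A (λ n → iter (proj₁ f) n (upB j A (fix j A (dn j (A ⇒ A) f))))

  -- the "if k > 0" clause: (fix^{k-1}_A , fix^k_A) ∈ ℒ^k_{(A→A)→A}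
  PosPart : ℕ → Ty → Set₁
  PosPart zero    A = Lift (lsuc lzero) ⊤
  PosPart (suc j) A = LRaw j (A ⇒ A) A (fix j A) (fix (suc j) A)

module Submission where

-- Classically each D^k_A is finite up to extensional equality (a predicate is a bit vector
-- over Q, a monotone map is determined by its values on an enumeration of its domain), so the
-- Kleene iteration of f from a point x with f x ≤ x (resp. x ≤ f x) stabilises and the meet
-- (resp. join) of the iterates is a fixpoint.  For d = fix^{k-1}(f^↓), the starting point
-- d^{↑⊤} (resp. d^{↑⊥}) is such an x because (f^↓, f) preserves ℒ and d is fixed by f^↓; the
-- same argument relates every iterate to d, giving (fix^{k-1}, fix^k) ∈ ℒ^k.

open import Defs
open import Level using (0ℓ; lift; lower)
open import Axiom.ExcludedMiddle using (ExcludedMiddle)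
open import Data.Bool using (true; false)
open import Data.Fin using (Fin; toℕ; funToFin; finToFun) renaming (zero to fzero; suc to fsuc)
open import Data.Fin.Properties using (pigeonhole; finToFun-funToFin; <⇒≢; toℕ-injective)
open import Data.Nat using (ℕ; zero; suc; _+_; _≤_; _<_; _^_; _≤′_; ≤′-refl; ≤′-step; s≤s)
open import Data.Nat.Properties
  using ( ≤-irrelevant; ≤-refl; ≤-trans; n<1+n; m≤n+m; m≤n⇒m≤1+n; +-suc; +-identityʳ
        ; m≤m⊔n; m≤n⊔m; ≤⇒≤′; <-cmp; ^-monoˡ-≤; ^-monoʳ-≤)
open import Data.Product using (Σ; ∃; ∃₂; _×_; _,_; proj₁; proj₂; swap)
open import Data.Unit using (tt)
open import Data.Vec.Functional using (_∷_)
open import Function using (_∘_; _$_; flip)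
open import Relation.Binary.Definitions using (tri<; tri≈; tri>)
open import Relation.Binary.PropositionalEquality using (_≡_; _≢_; refl; sym; trans; cong; subst)
open import Relation.Nullary using (¬_; Dec; yes; no; contradiction)
open import Relation.Nullary.Decidable using (decidable-stable)
open import Relation.Nullary.Negation using (¬¬-map)

pigeonhole-functions : ∀ {a b n} → b ^ a < n → (g : Fin n → Fin a → Fin b) →
                       ∃₂ λ i k → i ≢ k × (∀ r → g i r ≡ g k r)
pigeonhole-functions b^a<n g with i , k , i<k , gᵢ≡gₖ ← pigeonhole b^a<n (funToFin ∘ g) =
  i , k , <⇒≢ i<k , λ r → trans (sym (finToFun-funToFin (g i) r))
                         (trans (cong (λ c → finToFun c r) gᵢ≡gₖ) (finToFun-funToFin (g k) r))

¬¬-finite-choice : ∀ {b c} n {B : Set b} {C : Fin n → B → Set c} →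
                   (∀ i → ¬ ¬ Σ B (C i)) → ¬ ¬ Σ (Fin n → B) (λ g → ∀ i → C i (g i))
¬¬-finite-choice zero    h k = k ((λ ()) , (λ ()))
¬¬-finite-choice (suc n) h k = h fzero λ (b , c) →
  ¬¬-finite-choice n (h ∘ fsuc) λ (g , cg) →
    k ((b ∷ g) , λ { fzero → c ; (fsuc i) → cg i })

module BoundedPreorder {X : Set₁} (_≲_ : X → X → Set₁)
  (≲-refl : ∀ {x} → x ≲ x) (≲-trans : ∀ {x y z} → x ≲ y → y ≲ z → x ≲ z) where

  _≈_ : X → X → Set₁
  x ≈ y = x ≲ y × y ≲ x

  Distinct : ∀ {n} → (Fin n → X) → Set₁
  Distinct v = ∀ i k → i ≢ k → ¬ (v i ≈ v k)

  -- Classically: X has at most c elements up to ≈.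
  Bounded : ℕ → Set₁
  Bounded c = (v : Fin (suc c) → X) → ¬ Distinct v

  Complete : ∀ {n} → (Fin n → X) → Set₁
  Complete v = ∀ x → ¬ ¬ ∃ λ i → x ≈ v i

  Distinct-∷ : ∀ {n x} {v : Fin n → X} → Distinct v → ¬ (∃ λ i → x ≈ v i) → Distinct (x ∷ v)
  Distinct-∷ dv x∉v fzero    fzero    0≢0 = contradiction refl 0≢0
  Distinct-∷ dv x∉v fzero    (fsuc k) _   x≈vₖ = x∉v (k , x≈vₖ)
  Distinct-∷ dv x∉v (fsuc i) fzero    _   vᵢ≈x = x∉v (i , swap vᵢ≈x)
  Distinct-∷ dv x∉v (fsuc i) (fsuc k) i≢k = dv i k (i≢k ∘ cong fsuc)

  -- A distinct family that cannot be extended is complete; Bounded caps how far it can grow.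
  extend-to-enumeration : ∀ {c} → Bounded c → ∀ t {n} (v : Fin n → X) → Distinct v → t + n ≡ c →
                          ¬ ¬ ∃ λ m → m ≤ c × Σ (Fin m → X) Complete
  extend-to-enumeration bounded zero {n} v dv refl k =
    k (n , ≤-refl , v , λ x x∉v → bounded (x ∷ v) (Distinct-∷ dv x∉v))
  extend-to-enumeration bounded (suc t) {n} v dv t+n≡c k =
    k (n , subst (n ≤_) t+n≡c (m≤n+m n (suc t)) , v , λ x x∉v →
      extend-to-enumeration bounded t (x ∷ v) (Distinct-∷ dv x∉v) (trans (+-suc t n) t+n≡c) k)

  bounded⇒¬¬enumeration : ∀ {c} → Bounded c → ¬ ¬ ∃ λ m → m ≤ c × Σ (Fin m → X) Complete
  bounded⇒¬¬enumeration {c} bounded = extend-to-enumeration bounded c (λ ()) (λ ()) (+-identityʳ c)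

  module Descending (S : ℕ → X) (desc : ∀ n → S (suc n) ≲ S n) where

    antitone : ∀ {m n} → m ≤′ n → S n ≲ S m
    antitone ≤′-refl      = ≲-refl
    antitone (≤′-step m≤n) = ≲-trans (desc _) (antitone m≤n)

    stabilises : ∀ {c} → Bounded c → ¬ ¬ ∃ λ n → S n ≲ S (suc n)
    stabilises bounded never = bounded (S ∘ toℕ) distinct
      where
        strict : ∀ {a b} → a < b → ¬ (S a ≈ S b)
        strict a<b (Sa≲Sb , _) = never (_ , ≲-trans Sa≲Sb (antitone (≤⇒≤′ a<b)))

        distinct : Distinct (S ∘ toℕ)
        distinct i k i≢k with <-cmp (toℕ i) (toℕ k)
        ... | tri< a<b _ _ = strict a<b
        ... | tri≈ _ a≡b _ = contradiction (toℕ-injective a≡b) i≢k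
        ... | tri> _ _ b<a = strict b<a ∘ swap

  module _ (stable : ∀ {x y} → ¬ ¬ (x ≲ y) → x ≲ y) {c} (bounded : Bounded c)
           (⋀ : (ℕ → X) → X) (⋀-lb : ∀ S n → ⋀ S ≲ S n)
           (⋀-glb : ∀ S {y} → (∀ n → y ≲ S n) → y ≲ ⋀ S) where

    -- The descending chain of iterates stabilises at some S n, which then lies below every
    -- iterate and hence below their meet.
    meet-of-iterates-fixed : (F : X → X) → (∀ x y → x ≲ y → F x ≲ F y) →
                             ∀ x → F x ≲ x → F (⋀ (λ n → iter F n x)) ≈ ⋀ (λ n → iter F n x)
    meet-of-iterates-fixed F F-mono x Fx≲x =
      ⋀-glb S (λ n → ≲-trans (F-mono _ _ (⋀-lb S n)) (desc n)) ,
      stable (¬¬-map ⋀≲F⋀ (stabilises bounded))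
      where
        S : ℕ → X
        S n = iter F n x

        desc : ∀ n → S (suc n) ≲ S n
        desc zero    = Fx≲x
        desc (suc n) = F-mono _ _ (desc n)

        open Descending S desc

        ⋀≲F⋀ : ∃ (λ n → S n ≲ S (suc n)) → ⋀ S ≲ F (⋀ S)
        ⋀≲F⋀ (n , Sₙ≲Sₙ₊₁) = ≲-trans (⋀-lb S n) (≲-trans Sₙ≲Sₙ₊₁ (F-mono _ _ (⋀-glb S Sₙ≲)))
          where
            ascending : ∀ {m} → n ≤′ m → S n ≲ S m
            ascending ≤′-refl       = ≲-refl
            ascending (≤′-step n≤m) = ≲-trans Sₙ≲Sₙ₊₁ (F-mono _ _ (ascending n≤m))

            Sₙ≲ : ∀ m → S n ≲ S m
            Sₙ≲ m = ≲-trans (ascending (≤⇒≤′ (m≤m⊔n n m))) (antitone (≤⇒≤′ (m≤n⊔m n m)))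

module FixpointProperties {N : ℕ} (ρ : Fin N → ℕ) where
  open Dom ρ

  module Order j A = BoundedPreorder (Le j A) (Le-refl j A _) (Le-trans j A)
  module Dual j A = BoundedPreorder (flip (Le j A)) (Le-refl j A _) (flip (Le-trans j A))

  Meet-lb : ∀ j A (S : ℕ → D j A) n → Le j A (Meet j A S) (S n)
  Meet-lb j o       S n = lift (λ q Sq → Sq n)
  Meet-lb j (A ⇒ B) S n = λ x → Meet-lb j B (λ m → proj₁ (S m) x) n

  Meet-glb : ∀ j A (S : ℕ → D j A) {y} → (∀ n → Le j A y (S n)) → Le j A y (Meet j A S)
  Meet-glb j o       S y≤S = lift (λ q yq n → lower (y≤S n) q yq)
  Meet-glb j (A ⇒ B) S y≤S = λ x → Meet-glb j B (λ m → proj₁ (S m) x) (λ n → y≤S n x)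

  Join-ub : ∀ j A (S : ℕ → D j A) n → Le j A (S n) (Join j A S)
  Join-ub j o       S n = lift (λ q Sq → n , Sq)
  Join-ub j (A ⇒ B) S n = λ x → Join-ub j B (λ m → proj₁ (S m) x) n

  Join-lub : ∀ j A (S : ℕ → D j A) {y} → (∀ n → Le j A (S n) y) → Le j A (Join j A S) y
  Join-lub j o       S S≤y = lift (λ { q (n , Sq) → lower (S≤y n) q Sq })
  Join-lub j (A ⇒ B) S S≤y = λ x → Join-lub j B (λ m → proj₁ (S m) x) (λ n → S≤y n x)

  Le-top : ∀ j A x → Le j A x (top j A)
  Le-top j o       x = lift (λ _ _ → tt)
  Le-top j (A ⇒ B) x = λ y → Le-top j B (proj₁ x y)

  L-dn : ∀ j A x → L j A (dn j A x) x
  L-dn j o x = lift (λ q h h' → (λ p → subst (λ z → x (q , z)) (≤-irrelevant _ h') p)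
                             , (λ p → subst (λ z → x (q , z)) (≤-irrelevant h' _) p))
  L-dn j (A ⇒ B) x = proj₂ (proj₂ (proj₂ x))

  upT-greatest : ∀ j A d e → L j A d e → Le (suc j) A e (upT j A d)
  upT-greatest j o       d e dLe = lift (λ qh p h → proj₂ (lower dLe (proj₁ qh) h (proj₂ qh)) p)
  upT-greatest j (A ⇒ B) d e dLe = λ g → upT-greatest j B _ _ (dLe (dn j A g) g (L-dn j A g))

  upB-least : ∀ j A d e → L j A d e → Le (suc j) A (upB j A d) e
  upB-least j o       d e dLe = lift (λ qh p → proj₁ (lower dLe (proj₁ qh) (proj₁ p) (proj₂ qh)) (proj₂ p))
  upB-least j (A ⇒ B) d e dLe = λ g → upB-least j B _ _ (dLe (dn j A g) g (L-dn j A g))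

  L-Meetʳ : ∀ j A {d} {P : ℕ → D (suc j) A} → (∀ n → L j A d (P n)) → L j A d (Meet (suc j) A P)
  L-Meetʳ j A {d} dLP = L-respˡ j A (Meet-glb j A (λ _ → d) (λ _ → Le-refl j A d)) (Meet-lb j A (λ _ → d) 0)
                                    (L-meet j A dLP)

  L-Joinʳ : ∀ j A {d} {P : ℕ → D (suc j) A} → (∀ n → L j A d (P n)) → L j A d (Join (suc j) A P)
  L-Joinʳ j A {d} dLP = L-respˡ j A (Join-ub j A (λ _ → d) 0) (Join-lub j A (λ _ → d) (λ _ → Le-refl j A d))
                                    (L-join j A dLP)

  iter-mono : ∀ j A (f g : D j (A ⇒ A)) → Le j (A ⇒ A) f g → ∀ {x y} → Le j A x y → ∀ n →
              Le j A (iter (proj₁ f) n x) (iter (proj₁ g) n y)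
  iter-mono j A f g f≤g x≤y zero    = x≤y
  iter-mono j A f g f≤g x≤y (suc n) = Le-trans j A (f≤g _) (monoOf j A A g _ _ (iter-mono j A f g f≤g x≤y n))

  module _ j A {g₁ : D j (A ⇒ A)} {g₂ : D (suc j) (A ⇒ A)} (g₁Lg₂ : L j (A ⇒ A) g₁ g₂)
           {d} (d-fixed : Eq j A (proj₁ g₁ d) d) where

    L-step : ∀ {e} → L j A d e → L j A d (proj₁ g₂ e)
    L-step dLe = L-respˡ j A (proj₂ d-fixed) (proj₁ d-fixed) (g₁Lg₂ d _ dLe)

    L-iter : ∀ {e} → L j A d e → ∀ n → L j A d (iter (proj₁ g₂) n e)
    L-iter dLe zero    = dLe
    L-iter dLe (suc n) = L-step (L-iter dLe n)

  fix-mono : ∀ j A → Mono j (A ⇒ A) A (fix j A)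
  fix-mono zero A f g f≤g = Meet-mono zero A (iter-mono zero A f g f≤g (Le-refl zero A _))
  fix-mono (suc j) A f g f≤g with isEven (suc j) | fix-mono j A _ _ (dn-mono j (A ⇒ A) {f} {g} f≤g)
  ... | true  | fix↓-mono = Meet-mono (suc j) A (iter-mono (suc j) A f g f≤g (upT-mono j A fix↓-mono))
  ... | false | fix↓-mono = Join-mono (suc j) A (iter-mono (suc j) A f g f≤g (upB-mono j A fix↓-mono))

  fix-≈-dn : ∀ j A {g₁ : D j (A ⇒ A)} {g₂} → L j (A ⇒ A) g₁ g₂ → Eq j A (fix j A g₁) (fix j A (dn j (A ⇒ A) g₂))
  fix-≈-dn j A {g₁} {g₂} g₁Lg₂ with g₁≤g₂↓ , g₂↓≤g₁ ← L⇒≈dn j (A ⇒ A) {g₁} {g₂} g₁Lg₂ =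
    fix-mono j A _ _ g₁≤g₂↓ , fix-mono j A _ _ g₂↓≤g₁

  module Classical (em : ExcludedMiddle 0ℓ) where

    Le-stable : ∀ j A {x y} → ¬ ¬ Le j A x y → Le j A x y
    Le-stable j o       ¬¬x≤y = lift λ q xq → decidable-stable em (¬¬-map (λ x≤y → lower x≤y q xq) ¬¬x≤y)
    Le-stable j (A ⇒ B) ¬¬f≤g = λ x → Le-stable j B (¬¬-map (_$ x) ¬¬f≤g)

    bit : ∀ {P : Set} → Dec P → Fin 2
    bit (yes _) = fsuc fzero
    bit (no _)  = fzero

    bit-≡⇒ : ∀ {P P' : Set} (d : Dec P) (d' : Dec P') → bit d ≡ bit d' → P → P'
    bit-≡⇒ _       (yes p') _  _ = p'
    bit-≡⇒ (yes _) (no _)   ()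
    bit-≡⇒ (no ¬p) (no _)   _  p = contradiction p ¬p

    -- A predicate on Q_{≤ j} is recorded, up to extensional equality, by a bit for each q ∈ Q.
    code : ∀ j → D j o → Fin N → Fin 2
    code j P q = bit (em {Σ (ρ q ≤ j) (λ h → P (q , h))})

    same-code⇒Le : ∀ j {P P'} → (∀ q → code j P q ≡ code j P' q) → Le j o P P'
    same-code⇒Le j {P' = P'} same = lift λ (q , h) p →
      let h' , p' = bit-≡⇒ em em (same q) (h , p) in subst (λ z → P' (q , z)) (≤-irrelevant h' h) p'

    bounded-o : ∀ j → Order.Bounded j o (2 ^ N)
    bounded-o j Ps distinct =
      let i , k , i≢k , same = pigeonhole-functions (n<1+n _) (code j ∘ Ps)
      in distinct i k i≢k (same-code⇒Le j same , same-code⇒Le j (sym ∘ same))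

    Le-on-enumeration : ∀ j A B {n} {xs : Fin n → D j A} → Order.Complete j A xs → (f g : D j (A ⇒ B)) →
                        (∀ r → Le j B (proj₁ f (xs r)) (proj₁ g (xs r))) → Le j (A ⇒ B) f g
    Le-on-enumeration j A B complete f g f≤g x = Le-stable j B λ ¬fx≤gx → complete x λ (r , x≤xᵣ , xᵣ≤x) →
      ¬fx≤gx (Le-trans j B (monoOf j A B f _ _ x≤xᵣ) (Le-trans j B (f≤g r) (monoOf j A B g _ _ xᵣ≤x)))

    -- Each function is recorded by the indices of its values at an enumeration of D j A.
    bounded-⇒ : ∀ j A B {a b} → Order.Bounded j A a → Order.Bounded j B b → Order.Bounded j (A ⇒ B) (suc b ^ a)
    bounded-⇒ j A B {a} {b} bounded-A bounded-B fs distinct =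
      Order.bounded⇒¬¬enumeration j A bounded-A λ (nA , nA≤a , xs , xs-complete) →
      Order.bounded⇒¬¬enumeration j B bounded-B λ (nB , nB≤b , ys , ys-complete) →
      ¬¬-finite-choice _ (λ i → ¬¬-finite-choice nA λ r → ys-complete (proj₁ (fs i) (xs r))) λ (codes , fs≈ys) →
      let #codes≤ = ≤-trans (^-monoˡ-≤ nA (m≤n⇒m≤1+n nB≤b)) (^-monoʳ-≤ (suc b) nA≤a)
          i , k , i≢k , same = pigeonhole-functions (s≤s #codes≤) codes
          agree : ∀ i k → (∀ r → codes i r ≡ codes k r) → Le j (A ⇒ B) (fs i) (fs k)
          agree i k same = Le-on-enumeration j A B xs-complete (fs i) (fs k) λ r →
            Le-trans j B (proj₁ (fs≈ys i r)) (subst (λ c → Le j B (ys c) _) (sym (same r)) (proj₂ (fs≈ys k r)))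
      in distinct i k i≢k (agree i k same , agree k i (sym ∘ same))

    bounded : ∀ j A → Σ ℕ (Order.Bounded j A)
    bounded j o       = 2 ^ N , bounded-o j
    bounded j (A ⇒ B) = let a , bounded-A = bounded j A ; b , bounded-B = bounded j B
                        in suc b ^ a , bounded-⇒ j A B bounded-A bounded-B

    meet-of-iterates-fixed : ∀ j A (f : D j (A ⇒ A)) x → Le j A (proj₁ f x) x →
                             Eq j A (proj₁ f (Meet j A (λ n → iter (proj₁ f) n x))) (Meet j A (λ n → iter (proj₁ f) n x))
    meet-of-iterates-fixed j A f =
      Order.meet-of-iterates-fixed j A (Le-stable j A) (proj₂ (bounded j A)) (Meet j A) (Meet-lb j A) (Meet-glb j A)
                                   (proj₁ f) (monoOf j A A f)

    join-of-iterates-fixed : ∀ j A (f : D j (A ⇒ A)) x → Le j A x (proj₁ f x) →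
                             Eq j A (proj₁ f (Join j A (λ n → iter (proj₁ f) n x))) (Join j A (λ n → iter (proj₁ f) n x))
    join-of-iterates-fixed j A f x x≤fx =
      swap (Dual.meet-of-iterates-fixed j A (Le-stable j A) bounded-dual (Join j A) (Join-ub j A) (Join-lub j A)
                                        (proj₁ f) (λ x y → monoOf j A A f y x) x x≤fx)
      where
        bounded-dual : Dual.Bounded j A (proj₁ (bounded j A))
        bounded-dual v distinct = proj₂ (bounded j A) v λ i k i≢k → distinct k i (i≢k ∘ sym)

    fix-fixed : ∀ j A (f : D j (A ⇒ A)) → Eq j A (proj₁ f (fix j A f)) (fix j A f)
    fix-fixed zero    A f = meet-of-iterates-fixed zero A f (top zero A) (Le-top zero A _)
    fix-fixed (suc j) A f
      with isEven (suc j) | L-step j A {dn j (A ⇒ A) f} {f} (L-dn j (A ⇒ A) f) (fix-fixed j A (dn j (A ⇒ A) f))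
    ... | true  | f-step = meet-of-iterates-fixed (suc j) A f _ (upT-greatest j A _ _ (f-step (L-upT j A _)))
    ... | false | f-step = join-of-iterates-fixed (suc j) A f _ (upB-least j A _ _ (f-step (L-upB j A _)))

    fix-L : ∀ j A → LPres j (A ⇒ A) A (fix j A) (fix (suc j) A)
    fix-L j A g₁ g₂ g₁Lg₂
      with isEven (suc j) | L-iter j A {g₁} {g₂} g₁Lg₂ (fix-fixed j A g₁) | fix-≈-dn j A {g₁} {g₂} g₁Lg₂
    ... | true  | L-iterates | fix₁≤ , ≤fix₁ = L-Meetʳ j A (L-iterates (L-respˡ j A fix₁≤ ≤fix₁ (L-upT j A _)))
    ... | false | L-iterates | fix₁≤ , ≤fix₁ = L-Joinʳ j A (L-iterates (L-respˡ j A fix₁≤ ≤fix₁ (L-upB j A _)))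

    fix-∈D : ∀ j A → IsD j (A ⇒ A) A (fix j A)
    fix-∈D zero    A = fix-mono zero A
    fix-∈D (suc j) A = fix-mono (suc j) A , (fix j A , fix-∈D j A) , fix-L j A

    fix-PosPart : ∀ k A → PosPart k A
    fix-PosPart zero    A = lift tt
    fix-PosPart (suc j) A = fix-∈D j A , fix-mono (suc j) A , fix-L j A

lemma4p8 : ExcludedMiddle 0ℓ → ∀ {N : ℕ} (ρ : Fin N → ℕ) (k : ℕ) → k ≤ maxρ ρ → (A : Ty) →
    Dom.Mono ρ k (A ⇒ A) A (Dom.fix ρ k A)
    × Dom.PosPart ρ k A
    × (∀ (f : Dom.D ρ k (A ⇒ A)) → Dom.Eq ρ k A (proj₁ f (Dom.fix ρ k A f)) (Dom.fix ρ k A f))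
lemma4p8 em ρ k _ A = fix-mono k A , fix-PosPart k A , fix-fixed k A
  where open FixpointProperties ρ
        open Classical em
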